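{- Let $D=(v,init(v),next(v,v'),J)$ be a program and $\phi$ a $CTL^*$ formula. For every set of clauses $Clauses(v,init(v),next(v,v'),J,\phi)$ produced by the translation system ${\textsf{Trans}}$, if this set is satisfiable, then $D\models\phi$.
   Context: Fix a first-order background theory $\mathcal{T}$ with domain $\mathcal{E}$; an assertion is a formula of $\mathcal{T}$. A program is $D=(v,init(v),next(v,v'),J)$ where $v$ is a finite tuple of variables, $init(v)$ is an assertion (or a predicate application) over $v$, $next(v,v')$ is an assertion over $v$ and a primed copy $v'$, and $J=\{J_1,\dots,J_k\}$ is a finite list of assertions over $v$ (fairness conditions). States are valuations of $v$ in $\mathcal{E}$; a path is an infinite sequence of states $s_0s_1\dots$ with $next(s_i,s_{i+1})$ for all $i$; a path is fair if every $J_i$ holds at infinitely many of its states (if $J=\emptyset$ every path is fair). $CTL^*$ formulas are in negation normal form (negation only on assertions), built from assertions with $\wedge,\vee$, temporal operators $X,G,U$ (and $F\psi=\mathit{true}\,U\,\psi$), and path quantifiers $A,E$ (over all paths from a state) and $A_f,E_f$ (over fair paths from a state). $D\models\phi$ iff every state satisfying $init$ satisfies $\phi$. A basic state formula is $Q\psi$ with $Q$ a path quantifier and $\psi$ a path formula containing no path quantifiers. $\phi_1(\phi_2)$ denotes a formula with one or more occurrences of a subformula $\phi_2$, and $\phi_1(\gamma)$ the result of replacing them by $\gamma$. Clauses (Existential Horn Clauses) are implications $body\to head$ over uninterpreted predicate symbols, with all free variables universally quantified, where bodies/heads are built from assertions and predicate applications (heads may contain $\exists$), together with constraints $dwf(r)$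 for binary (pairs-of-states) predicates $r$. A set of clauses is satisfiable if there is an interpretation $\mathcal{I}$ assigning to each predicate symbol of arity $n$ a subset of $\mathcal{E}^n$ such that all implications are true for all values of their free variables and, for each constraint $dwf(r)$, $\mathcal{I}(r)$ is disjunctively well-founded (contained in a finite union of well-founded relations). ${\textsf{Trans}}$ is the nondeterministic recursive procedure computing $Clauses(v,init(v),next(v,v'),J,\phi)$ (write $D$ for the first four arguments) by the following rules, each applied whenever its pattern matches; any set obtainable is a result of ${\textsf{Trans}}$. (1) If $\phi_1$ is a basic state subformula of $\phi_2(\phi_1)$, with $aux$ a fresh predicate of arity $|v|$: $Clauses(D,\phi_2(\phi_1))=Clauses(v,aux(v),next,J,\phi_1)\cup Clauses(D,\phi_2(aux(v)))$. (2) For a basic state formula $Q\psi$ with $Q\in\{A,E\}$ and $Q_f$ its fair version: $Clauses(D,Q\psi)=Clauses(v,init,next,\emptyset,Q_f\psi)$. (3) For an assertion $c$ and fresh boolean variable $x_X$: $Clauses(D,A_f\psi(Xc))=Clauses(v\cup\{x_X\},init(v),next\wedge(x_X=c(v')),J,A_f\psi(x_X))$; and with $aux$ fresh of arity $|v|+1$: $Clauses(D,E_f\psi(Xc))=\{init(v)\to\exists x_X\,aux(v,x_X)\}\cup Clauses(v\cup\{x_X\},aux(v,x_X),next\wedge(x_X=c(v')),J,E_f\psi(x_X))$. (4) Same as (3) with $Gc$, fresh $x_G$, conjunct $x_G=(c(v)\wedge x_G')$ added to $next$ and $J$ replaced by $J\cup\{x_G\vee\neg c(v)\}$. (5) Same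 as (3) with $c_1Uc_2$ ($c_1,c_2$ assertions), fresh $x_U$, conjunct $x_U=(c_2(v)\vee(c_1(v)\wedge x_U'))$ added to $next$ and $J$ replaced by $J\cup\{\neg x_U\vee c_2(v)\}$. (6) For an assertion $c$, fresh $p$ (arity $|v|$) and $r,t$ (arity $2|v|$), copies $v_0,\dots,v_k$ of $v$: if $J\ne\emptyset$, $Clauses(D,A_fc)=\{init(v)\wedge\neg c(v)\to p(v),\ next(v,v')\wedge p(v)\to p(v'),\ p(v_0)\wedge\bigwedge_{i=1}^{k}(t(v_{i-1},v_i)\wedge J_i(v_i))\to r(v_0,v_k),\ dwf(r),\ next(v,v')\to t(v,v'),\ t(v,v')\wedge next(v',v'')\to t(v,v'')\}$; if $J=\emptyset$, the same but with the third clause replaced by $p(v)\wedge t(v,v')\to r(v,v')$. (7) For an assertion $c$, fresh $q_1,\dots,q_k$ (arity $|v|$), $r_1,\dots,r_k$ (arity $2|v|$): if $J\neq\emptyset$, $Clauses(D,E_fc)=\{init(v)\to c(v)\wedge q_1(v)\}\cup\{q_i(v)\to\exists v'.\,next(v,v')\wedge((J_i(v)\wedge q_{(i\bmod k)+1}(v'))\vee(r_i(v,v')\wedge q_i(v'))),\ dwf(r_i),\ r_i(v,v')\wedge r_i(v',v'')\to r_i(v,v'')\mid i\le k\}$; if $J=\emptyset$, with $q$ fresh: $\{init(v)\to c(v)\wedge q(v),\ q(v)\to\exists v'.\,next(v,v')\wedge q(v')\}$. (8) For an assertion $c$: $Clauses(D,c)=\{init(v)\to c(v)\}$. -}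

module Defs where

open import Level using (Level; 0ℓ; Lift) renaming (suc to lsuc)
open import Data.Nat using (ℕ; zero; suc; _+_; _≤_; _<_; NonZero)
open import Data.Nat.DivMod using (_mod_)
open import Data.Fin using (Fin; toℕ; inject₁; fromℕ) renaming (zero to fzero; suc to fsuc)
open import Data.Bool using (Bool; true; false; _∨_)
open import Data.List using (List; []; _∷_; _++_; length; lookup; map; concatMap; allFin)
open import Data.List.Relation.Unary.All using (All)
open import Data.List.Relation.Unary.Any using (Any)
open import Data.Product using (Σ; _×_; _,_; proj₁; proj₂)
open import Data.Sum using (_⊎_)
open import Data.Unit using (⊤)
open import Data.Empty using (⊥)
open import Relation.Nullary using (¬_)
open import Relation.Binary.PropositionalEquality using (_≡_)
open import Induction.WellFounded using (WellFounded)
open import Function using (flip)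

-- Atoms stand for assertions (negation is pushed into the atoms, since
-- assertions are closed under negation).  F ψ is the derived form
-- (atom true) U ψ and needs no constructor.

data Quant : Set where
  𝔸 𝔼 𝔸f 𝔼f : Quant

data SF (A : Set₁) : Set₁
data PF (A : Set₁) : Set₁

data SF A where
  atom : A → SF A
  _∧ₛ_ : SF A → SF A → SF A
  _∨ₛ_ : SF A → SF A → SF A
  Q    : Quant → PF A → SF A

data PF A where
  st   : SF A → PF A
  _∧ₚ_ : PF A → PF A → PF A
  _∨ₚ_ : PF A → PF A → PF A
  X    : PF A → PF A
  G    : PF A → PF A
  _U_  : PF A → PF A → PF A

mapS : ∀ {A B : Set₁} → (A → B) → SF A → SF B
mapP : ∀ {A B : Set₁} → (A → B) → PF A → PF B
mapS f (atom a) = atom (f a)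
mapS f (φ ∧ₛ ψ) = mapS f φ ∧ₛ mapS f ψ
mapS f (φ ∨ₛ ψ) = mapS f φ ∨ₛ mapS f ψ
mapS f (Q q ψ) = Q q (mapP f ψ)
mapP f (st φ) = st (mapS f φ)
mapP f (φ ∧ₚ ψ) = mapP f φ ∧ₚ mapP f ψ
mapP f (φ ∨ₚ ψ) = mapP f φ ∨ₚ mapP f ψ
mapP f (X φ) = X (mapP f φ)
mapP f (G φ) = G (mapP f φ)
mapP f (φ U ψ) = mapP f φ U mapP f ψ

NoQS : ∀ {A} → SF A → Set
NoQP : ∀ {A} → PF A → Set
NoQS (atom _) = ⊤
NoQS (φ ∧ₛ ψ) = NoQS φ × NoQS ψ
NoQS (φ ∨ₛ ψ) = NoQS φ × NoQS ψ
NoQS (Q _ _) = ⊥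
NoQP (st φ) = NoQS φ
NoQP (φ ∧ₚ ψ) = NoQP φ × NoQP ψ
NoQP (φ ∨ₚ ψ) = NoQP φ × NoQP ψ
NoQP (X φ) = NoQP φ
NoQP (G φ) = NoQP φ
NoQP (φ U ψ) = NoQP φ × NoQP ψ

IsAssnS : ∀ {A} → SF A → Set
IsAssnS = NoQS

IsAssnP : ∀ {A} → PF A → Set
IsAssnP (st φ) = IsAssnS φ
IsAssnP (φ ∧ₚ ψ) = IsAssnP φ × IsAssnP ψ
IsAssnP (φ ∨ₚ ψ) = IsAssnP φ × IsAssnP ψ
IsAssnP (X _) = ⊥
IsAssnP (G _) = ⊥
IsAssnP (_ U _) = ⊥

Basic : ∀ {A} → SF A → Set
Basic (Q _ ψ) = NoQP ψ
Basic _ = ⊥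

-- RepS a b h φ φ' : φ' is obtained from φ by
-- replacing some occurrences of the state subformula a by b; h = true
-- iff at least one occurrence was replaced.  (So φ = φ₂(a), φ' = φ₂(b).)

data RepS {A : Set₁} (a b : SF A) : Bool → SF A → SF A → Set₁
data RepSP {A : Set₁} (a b : SF A) : Bool → PF A → PF A → Set₁

data RepS {A} a b where
  hit  : RepS a b true a b
  atom : ∀ {c} → RepS a b false (atom c) (atom c)
  and  : ∀ {h h' φ φ' ψ ψ'} → RepS a b h φ φ' → RepS a b h' ψ ψ' →
         RepS a b (h ∨ h') (φ ∧ₛ ψ) (φ' ∧ₛ ψ')
  or   : ∀ {h h' φ φ' ψ ψ'} → RepS a b h φ φ' → RepS a b h' ψ ψ' →
         RepS a b (h ∨ h') (φ ∨ₛ ψ) (φ' ∨ₛ ψ')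
  quant : ∀ {h q ψ ψ'} → RepSP a b h ψ ψ' → RepS a b h (Q q ψ) (Q q ψ')

data RepSP {A} a b where
  st   : ∀ {h φ φ'} → RepS a b h φ φ' → RepSP a b h (st φ) (st φ')
  and  : ∀ {h h' φ φ' ψ ψ'} → RepSP a b h φ φ' → RepSP a b h' ψ ψ' →
         RepSP a b (h ∨ h') (φ ∧ₚ ψ) (φ' ∧ₚ ψ')
  or   : ∀ {h h' φ φ' ψ ψ'} → RepSP a b h φ φ' → RepSP a b h' ψ ψ' →
         RepSP a b (h ∨ h') (φ ∨ₚ ψ) (φ' ∨ₚ ψ')
  nxt : ∀ {h φ φ'} → RepSP a b h φ φ' → RepSP a b h (X φ) (X φ')
  glb : ∀ {h φ φ'} → RepSP a b h φ φ' → RepSP a b h (G φ) (G φ')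
  unt : ∀ {h h' φ φ' ψ ψ'} → RepSP a b h φ φ' → RepSP a b h' ψ ψ' →
         RepSP a b (h ∨ h') (φ U ψ) (φ' U ψ')

-- RepP a b h ψ ψ' : replacement of occurrences of the path subformula a
-- by b inside a path formula free of path quantifiers (used for ψ(Xc) etc.)
data RepP {A : Set₁} (a b : PF A) : Bool → PF A → PF A → Set₁ where
  hit  : RepP a b true a b
  st   : ∀ {φ} → RepP a b false (st φ) (st φ)
  and  : ∀ {h h' φ φ' ψ ψ'} → RepP a b h φ φ' → RepP a b h' ψ ψ' →
         RepP a b (h ∨ h') (φ ∧ₚ ψ) (φ' ∧ₚ ψ')
  or   : ∀ {h h' φ φ' ψ ψ'} → RepP a b h φ φ' → RepP a b h' ψ ψ' →
         RepP a b (h ∨ h') (φ ∨ₚ ψ) (φ' ∨ₚ ψ')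
  nxt : ∀ {h φ φ'} → RepP a b h φ φ' → RepP a b h (X φ) (X φ')
  glb : ∀ {h φ φ'} → RepP a b h φ φ' → RepP a b h (G φ) (G φ')
  unt : ∀ {h h' φ φ' ψ ψ'} → RepP a b h φ φ' → RepP a b h' ψ ψ' →
         RepP a b (h ∨ h') (φ U ψ) (φ' U ψ')

-- Sorts of program variables: the original variables range over the
-- domain E, the auxiliary variables x_X, x_G, x_U are boolean.

data Sort : Set where
  ent bool : Sort

Sig : Set
Sig = List Sort

module CTL (E : Set) where

  ⟦_⟧ₛ : Sort → Set
  ⟦ ent ⟧ₛ = E
  ⟦ bool ⟧ₛ = Bool

  State : Sig → Set
  State [] = ⊤
  State (s ∷ σ) = ⟦ s ⟧ₛ × State σ

  -- concatenation of tuples (argument of a predicate of arity |v|+|v|)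
  _⊕_ : ∀ {σ τ} → State σ → State τ → State (σ ++ τ)
  _⊕_ {[]} _ t = t
  _⊕_ {s ∷ σ} (x , u) t = x , (u ⊕ t)

  Pred : Sig → Set₁
  Pred σ = State σ → Set

  record Program (σ : Sig) : Set₁ where
    field
      init : Pred σ
      next : State σ → State σ → Set
      fair : List (Pred σ)
  open Program

  Path : Sig → Set
  Path σ = ℕ → State σ

  IsPath : ∀ {σ} → Program σ → Path σ → Set
  IsPath D π = ∀ i → next D (π i) (π (suc i))

  InfOften : ∀ {σ} → Pred σ → Path σ → Set
  InfOften P π = ∀ i → Σ ℕ λ j → i ≤ j × P (π j)

  IsFair : ∀ {σ} → Program σ → Path σ → Set
  IsFair D π = ∀ (i : Fin (length (fair D))) → InfOften (lookup (fair D) i) π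

  shift : ∀ {σ} → ℕ → Path σ → Path σ
  shift k π i = π (k + i)

  sat  : ∀ {σ} → Program σ → SF (Pred σ) → State σ → Set
  psat : ∀ {σ} → Program σ → PF (Pred σ) → Path σ → Set
  sat D (atom c) s = c s
  sat D (φ ∧ₛ ψ) s = sat D φ s × sat D ψ s
  sat D (φ ∨ₛ ψ) s = sat D φ s ⊎ sat D ψ s
  sat D (Q 𝔸 ψ) s = ∀ π → π 0 ≡ s → IsPath D π → psat D ψ π
  sat D (Q 𝔼 ψ) s = Σ (Path _) λ π → π 0 ≡ s × IsPath D π × psat D ψ π
  sat D (Q 𝔸f ψ) s = ∀ π → π 0 ≡ s → IsPath D π → IsFair D π → psat D ψ π
  sat D (Q 𝔼f ψ) s =
    Σ (Path _) λ π → π 0 ≡ s × IsPath D π × IsFair D π × psat D ψ π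
  psat D (st φ) π = sat D φ (π 0)
  psat D (φ ∧ₚ ψ) π = psat D φ π × psat D ψ π
  psat D (φ ∨ₚ ψ) π = psat D φ π ⊎ psat D ψ π
  psat D (X ψ) π = psat D ψ (shift 1 π)
  psat D (G ψ) π = ∀ k → psat D ψ (shift k π)
  psat D (φ U ψ) π =
    Σ ℕ λ k → psat D ψ (shift k π) × (∀ j → j < k → psat D φ (shift j π))

  _⊨_ : ∀ {σ} → Program σ → SF (Pred σ) → Set
  D ⊨ φ = ∀ s → init D s → sat D φ s

  -- value of an assertion (only used on formulas satisfying IsAssnS/P)
  evalS : ∀ {σ} → SF (Pred σ) → Pred σ
  evalP : ∀ {σ} → PF (Pred σ) → Pred σ
  evalS (atom c) s = c s
  evalS (φ ∧ₛ ψ) s = evalS φ s × evalS ψ s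
  evalS (φ ∨ₛ ψ) s = evalS φ s ⊎ evalS ψ s
  evalS (Q _ _) s = ⊥
  evalP (st φ) s = evalS φ s
  evalP (φ ∧ₚ ψ) s = evalP φ s × evalP ψ s
  evalP (φ ∨ₚ ψ) s = evalP φ s ⊎ evalP ψ s
  evalP (X _) s = ⊥
  evalP (G _) s = ⊥
  evalP (_ U _) s = ⊥

  -- A predicate symbol is a name (ℕ) with an arity (a signature); an
  -- interpretation assigns to each symbol a subset of its tuples.
  Interp : Set₁
  Interp = ℕ → (τ : Sig) → State τ → Set

  bin : Interp → ℕ → (σ : Sig) → State σ → State σ → Set
  bin I m σ s s' = I m (σ ++ σ) (s ⊕ s')

  -- well-founded relation (no infinite chain x₀ R x₁ R x₂ …)
  WF : ∀ {B : Set} → (B → B → Set) → Set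
  WF R = WellFounded (flip R)

  DWF : ∀ {B : Set} → (B → B → Set) → Set₁
  DWF {B} R = Σ (List (B → B → Set)) λ Rs →
    All WF Rs × (∀ x y → R x y → Any (λ Ri → Ri x y) Rs)

  -- A clause is either an implication (represented by its meaning under an
  -- interpretation, all free variables universally quantified) or a
  -- constraint dwf(r) for a binary predicate symbol r.
  data Clause : Set₁ where
    horn : (Interp → Set) → Clause
    dwf  : ℕ → Sig → Clause

  Holds : Interp → Clause → Set₁
  Holds I (horn P) = Lift (lsuc 0ℓ) (P I)
  Holds I (dwf m σ) = DWF (bin I m σ)

  Satisfiable : List Clause → Set₁
  Satisfiable Cs = Σ Interp λ I → All (Holds I) Cs

  -- Symbolic programs and formulas occurring during the translation: their
  -- assertions may mention the uninterpreted predicates, so they are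
  -- given as functions of the interpretation.

  Atom : Sig → Set₁
  Atom σ = Interp → Pred σ

  record SProg (σ : Sig) : Set₁ where
    field
      Init : Atom σ
      Next : Interp → State σ → State σ → Set
      Fair : List (Atom σ)
  open SProg

  liftProg : ∀ {σ} → Program σ → SProg σ
  liftProg D = record
    { Init = λ _ → init D ; Next = λ _ → next D ; Fair = map (λ P _ → P) (fair D) }

  liftF : ∀ {σ} → SF (Pred σ) → SF (Atom σ)
  liftF = mapS (λ P _ → P)

  evS : ∀ {σ} → Interp → SF (Atom σ) → Pred σ
  evS I c = evalS (mapS (λ a → a I) c)

  evP : ∀ {σ} → Interp → PF (Atom σ) → Pred σ
  evP I c = evalP (mapP (λ a → a I) c)

  app : ∀ {σ} → ℕ → Atom σ
  app {σ} p I s = I p σ s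

  withInit : ∀ {σ} → SProg σ → Atom σ → SProg σ
  withInit D a = record { Init = a ; Next = Next D ; Fair = Fair D }

  noFair : ∀ {σ} → SProg σ → SProg σ
  noFair D = record { Init = Init D ; Next = Next D ; Fair = [] }

  -- adding a fresh boolean variable x (the first component of the state)
  wkA : ∀ {σ} → Atom σ → Atom (bool ∷ σ)
  wkA a I s = a I (proj₂ s)

  wkP : ∀ {σ} → PF (Atom σ) → PF (Atom (bool ∷ σ))
  wkP = mapP wkA

  xAt : ∀ {σ} → Atom (bool ∷ σ)
  xAt I s = proj₁ s ≡ true

  _⇔_ : Set → Set → Set
  P ⇔ R = (P → R) × (R → P)

  -- the three temporal patterns of rules (3),(4),(5)
  data Temp (σ : Sig) : Set₁ where
    tX : PF (Atom σ) → Temp σ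
    tG : PF (Atom σ) → Temp σ
    tU : PF (Atom σ) → PF (Atom σ) → Temp σ

  TempOK : ∀ {σ} → Temp σ → Set
  TempOK (tX c) = IsAssnP c
  TempOK (tG c) = IsAssnP c
  TempOK (tU c₁ c₂) = IsAssnP c₁ × IsAssnP c₂

  pat : ∀ {σ} → Temp σ → PF (Atom σ)
  pat (tX c) = X c
  pat (tG c) = G c
  pat (tU c₁ c₂) = c₁ U c₂

  tNext : ∀ {σ} → Temp σ → Interp → State (bool ∷ σ) → State (bool ∷ σ) → Set
  tNext (tX c) I (x , s) (x' , s') = (x ≡ true) ⇔ evP I c s'
  tNext (tG c) I (x , s) (x' , s') = (x ≡ true) ⇔ (evP I c s × x' ≡ true)
  tNext (tU c₁ c₂) I (x , s) (x' , s') =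
    (x ≡ true) ⇔ (evP I c₂ s ⊎ (evP I c₁ s × x' ≡ true))

  tFair : ∀ {σ} → Temp σ → List (Atom (bool ∷ σ))
  tFair (tX c) = []
  tFair (tG c) = (λ I s → proj₁ s ≡ true ⊎ ¬ evP I c (proj₂ s)) ∷ []
  tFair (tU c₁ c₂) = (λ I s → proj₁ s ≡ false ⊎ evP I c₂ (proj₂ s)) ∷ []

  extend : ∀ {σ} → SProg σ → Atom (bool ∷ σ) → Temp σ → SProg (bool ∷ σ)
  extend D ini T = record
    { Init = ini
    ; Next = λ I s s' → Next D I (proj₂ s) (proj₂ s') × tNext T I s s'
    ; Fair = map wkA (Fair D) ++ tFair T }

  -- (i mod k) + 1 in 1-based indexing, i.e. the cyclic successor
  cyc : ∀ {k} → Fin k → Fin k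
  cyc {zero} ()
  cyc {suc k} i = suc (toℕ i) mod suc k

  -- Rule (6) clauses, with p = n, r = n+1, t = n+2
  clausesAf : ∀ {σ} → ℕ → SProg σ → PF (Atom σ) → List Clause
  clausesAf {σ} n D c =
      horn (λ I → ∀ s → Init D I s → ¬ evP I c s → I p σ s)
    ∷ horn (λ I → ∀ s s' → Next D I s s' → I p σ s → I p σ s')
    ∷ third (Fair D)
    ∷ dwf r σ
    ∷ horn (λ I → ∀ s s' → Next D I s s' → bin I t σ s s')
    ∷ horn (λ I → ∀ s s' s'' → bin I t σ s s' → Next D I s' s'' → bin I t σ s s'')
    ∷ []
    where
      p r t : ℕ
      p = n
      r = suc n
      t = suc (suc n)
      third : List (Atom σ) → Clause
      third [] = horn (λ I → ∀ s s' → I p σ s → bin I t σ s s' → bin I r σ s s')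
      third J@(_ ∷ _) = horn (λ I →
        ∀ (vs : Fin (suc (length J)) → State σ) →
        I p σ (vs fzero) →
        (∀ (i : Fin (length J)) →
           bin I t σ (vs (inject₁ i)) (vs (fsuc i)) × lookup J i I (vs (fsuc i))) →
        bin I r σ (vs fzero) (vs (fromℕ (length J))))

  -- Rule (7) clauses, J = J₁ … J_k nonempty,
  -- q_i = n + (i-1), r_i = n + k + (i-1)
  clausesEf : ∀ {σ} → ℕ → SProg σ → PF (Atom σ) → List Clause
  clausesEf {σ} n D c = go (Fair D)
    where
      -- J = Fair D ; only used when J is nonempty
      go : List (Atom σ) → List Clause
      go [] = []
      go J@(_ ∷ _) =
          horn (λ I → ∀ s → Init D I s → evP I c s × I (q fzero) σ s)
        ∷ concatMap per (allFin k)
        where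
          k = length J
          q r : Fin k → ℕ
          q i = n + toℕ i
          r i = n + k + toℕ i
          per : Fin k → List Clause
          per i =
              horn (λ I → ∀ s → I (q i) σ s → Σ (State σ) λ s' → Next D I s s' ×
                     ((lookup J i I s × I (q (cyc i)) σ s')
                      ⊎ (bin I (r i) σ s s' × I (q i) σ s')))
            ∷ dwf (r i) σ
            ∷ horn (λ I → ∀ s s' s'' → bin I (r i) σ s s' → bin I (r i) σ s' s'' →
                     bin I (r i) σ s s'')
            ∷ []

  -- Rule (7) clauses, J = ∅, q = n
  clausesEf∅ : ∀ {σ} → ℕ → SProg σ → PF (Atom σ) → List Clause
  clausesEf∅ {σ} n D c =
      horn (λ I → ∀ s → Init D I s → evP I c s × I n σ s)
    ∷ horn (λ I → ∀ s → I n σ s → Σ (State σ) λ s' → Next D I s s' × I n σ s')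
    ∷ []

  -- The nondeterministic translation Trans.
  -- Trans n D φ Cs m : Cs is a possible value of Clauses(D, φ), where the
  -- fresh predicate symbols used are named n, n+1, …, m-1 (freshness).

  data Trans : ∀ {σ} → ℕ → SProg σ → SF (Atom σ) → List Clause → ℕ → Set₁ where
    r1 : ∀ {σ n m k} {D : SProg σ} {φ φ₁ φ' C₁ C₂} →
         Basic φ₁ → RepS φ₁ (atom (app n)) true φ φ' →
         Trans (suc n) (withInit D (app n)) φ₁ C₁ m →
         Trans m D φ' C₂ k →
         Trans n D φ (C₁ ++ C₂) k
    r2A : ∀ {σ n m} {D : SProg σ} {ψ C} → NoQP ψ →
          Trans n (noFair D) (Q 𝔸f ψ) C m → Trans n D (Q 𝔸 ψ) C m
    r2E : ∀ {σ n m} {D : SProg σ} {ψ C} → NoQP ψ →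
          Trans n (noFair D) (Q 𝔼f ψ) C m → Trans n D (Q 𝔼 ψ) C m
    r345A : ∀ {σ n m} {D : SProg σ} {ψ ψ' C} (T : Temp σ) →
          NoQP ψ → TempOK T →
          RepP (wkP (pat T)) (st (atom xAt)) true (wkP ψ) ψ' →
          Trans n (extend D (wkA (Init D)) T) (Q 𝔸f ψ') C m →
          Trans n D (Q 𝔸f ψ) C m
    r345E : ∀ {σ n m} {D : SProg σ} {ψ ψ' C} (T : Temp σ) →
          NoQP ψ → TempOK T →
          RepP (wkP (pat T)) (st (atom xAt)) true (wkP ψ) ψ' →
          Trans (suc n) (extend D (app n) T) (Q 𝔼f ψ') C m →
          Trans n D (Q 𝔼f ψ)
            (horn (λ I → ∀ s → SProg.Init D I s →
                     Σ Bool λ x → I n (bool ∷ σ) (x , s)) ∷ C) m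
    r6 : ∀ {σ n} {D : SProg σ} {c} → IsAssnP c →
         Trans n D (Q 𝔸f c) (clausesAf n D c) (3 + n)
    r7 : ∀ {σ n} {D : SProg σ} {c} → IsAssnP c → ¬ (Fair D ≡ []) →
         Trans n D (Q 𝔼f c) (clausesEf n D c) (n + length (Fair D) + length (Fair D))
    r7∅ : ∀ {σ n} {D : SProg σ} {c} → IsAssnP c → Fair D ≡ [] →
          Trans n D (Q 𝔼f c) (clausesEf∅ n D c) (suc n)
    r8 : ∀ {σ n} {D : SProg σ} {c} → IsAssnS c →
         Trans n D c (horn (λ I → ∀ s → Init D I s → evS I c s) ∷ []) n

module Submission where

open import Defs
open import Level using (Level; 0ℓ; lift; lower)
open import Axiom.ExcludedMiddle using (ExcludedMiddle)
open import Axiom.DoubleNegationElimination using (DoubleNegationElimination; em⇒dne)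
open import Data.Bool using (Bool; true; false)
open import Data.Fin using (Fin; zero; suc; toℕ; inject₁; fromℕ)
open import Data.Fin.Properties using (toℕ<n; toℕ-fromℕ<; toℕ-injective)
open import Data.List using (List; []; _∷_; length; lookup; map; concatMap; allFin; replicate)
open import Data.List.Properties using (map-∘; map-id)
open import Data.List.Relation.Unary.All as All using (All; []; _∷_)
import Data.List.Relation.Unary.All.Properties as Allₚ
open import Data.List.Relation.Unary.Any as Any using (Any)
open import Data.List.Relation.Unary.Any.Properties using (lookup-index)
open import Data.List.Membership.Propositional.Properties using (∈-lookup)
open import Data.Nat
  using (ℕ; zero; suc; _+_; _∸_; _%_; NonZero; _≤_; _<_; _≤′_; ≤′-refl; ≤′-step; z≤n; s≤s; _<?_)
open import Data.Nat.DivMod using (%-distribˡ-+; m%n%n≡m%n; m<n⇒m%n≡m; [m+n]%n≡m%n)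
open import Data.Nat.InfinitelyOften using (_∪-Fin_) renaming (Fin to Finitely)
open import Data.Nat.Properties
  using (≤-refl; ≤-trans; ≤-<-trans; <⇒≤; n≤1+n; n<1+n; m≤m+n; m≤n+m; ≤⇒≤′; ≤′⇒≤;
         +-suc; +-comm; +-assoc; +-identityʳ; m∸n+n≡m)
open import Data.Product using (Σ; ∃-syntax; ∃₂; _×_; _,_; proj₁; proj₂)
open import Data.Sum using (_⊎_; inj₁; inj₂; [_,_]′)
open import Data.Unit using (⊤; tt)
open import Function using (_∘_; id; flip)
open import Induction.WellFounded using (WellFounded; Acc; acc)
open import Relation.Nullary using (¬_; Dec; yes; no; does; contradiction)
open import Relation.Nullary.Decidable using (dec-true)
open import Relation.Binary.PropositionalEquality
  using (_≡_; _≗_; refl; sym; trans; cong; cong₂; subst; subst₂; module ≡-Reasoning)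
open ≡-Reasoning

-- By induction on the derivation of the translation: for every interpretation I of the predicate symbols
-- that satisfies the clauses, the program with its assertions evaluated in I satisfies the formula
-- evaluated in I.  Rule (1) is monotonicity of formulas in negation normal form, I(aux) being a set of
-- initial states from which φ₁ holds.  For rules (3)–(5), on the universal side the fresh boolean is set,
-- by excluded middle, to the truth of Xc, Gc or c₁Uc₂ on the current suffix, which meets the new
-- transition constraint and fairness condition; on the existential side these constraints force the
-- boolean to imply the temporal formula.  Rule (6): if c failed initially on a fair path, p would hold
-- all along it and r would relate any two of its states separated by a round of visits to J₁, …, J_k;
-- by Ramsey's theorem such an infinite chain contradicts disjunctive well-foundedness of r.  Rule (7):
-- following the existential clauses builds a path on which phase i is left only through a J_i-state;
-- staying in one phase forever would give an infinite transitive r_i-chain, so every phase recurs.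

does≡true⇒ : ∀ {A : Set} (a? : Dec A) → does a? ≡ true → A
does≡true⇒ (yes a) _ = a

lookup⇒All : ∀ {a p} {A : Set a} {P : A → Set p} (xs : List A) → (∀ i → P (lookup xs i)) → All P xs
lookup⇒All [] _ = []
lookup⇒All (x ∷ xs) Pxs = Pxs zero ∷ lookup⇒All xs (Pxs ∘ suc)

All-concatMap-allFin⁻ : ∀ {a p} {A : Set a} {P : A → Set p} {k} (f : Fin k → List A) →
  All P (concatMap f (allFin k)) → ∀ i → All P (f i)
All-concatMap-allFin⁻ f all = Allₚ.tabulate⁻ (Allₚ.map⁻ (Allₚ.concat⁻ all))

mapS-inverse : ∀ {A B : Set₁} {f : A → B} {g : B → A} → (∀ a → g (f a) ≡ a) →
  ∀ φ → mapS g (mapS f φ) ≡ φ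
mapP-inverse : ∀ {A B : Set₁} {f : A → B} {g : B → A} → (∀ a → g (f a) ≡ a) →
  ∀ ψ → mapP g (mapP f ψ) ≡ ψ
mapS-inverse inv (atom a) = cong atom (inv a)
mapS-inverse inv (φ ∧ₛ ψ) = cong₂ _∧ₛ_ (mapS-inverse inv φ) (mapS-inverse inv ψ)
mapS-inverse inv (φ ∨ₛ ψ) = cong₂ _∨ₛ_ (mapS-inverse inv φ) (mapS-inverse inv ψ)
mapS-inverse inv (Q q ψ) = cong (Q q) (mapP-inverse inv ψ)
mapP-inverse inv (st φ) = cong st (mapS-inverse inv φ)
mapP-inverse inv (φ ∧ₚ ψ) = cong₂ _∧ₚ_ (mapP-inverse inv φ) (mapP-inverse inv ψ)
mapP-inverse inv (φ ∨ₚ ψ) = cong₂ _∨ₚ_ (mapP-inverse inv φ) (mapP-inverse inv ψ)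
mapP-inverse inv (X ψ) = cong X (mapP-inverse inv ψ)
mapP-inverse inv (G ψ) = cong G (mapP-inverse inv ψ)
mapP-inverse inv (φ U ψ) = cong₂ _U_ (mapP-inverse inv φ) (mapP-inverse inv ψ)

acc⇒¬chain : ∀ {B : Set} {R : B → B → Set} (x : ℕ → B) →
  Acc (flip R) (x 0) → ¬ (∀ t → R (x t) (x (suc t)))
acc⇒¬chain x (acc rs) chain = acc⇒¬chain (x ∘ suc) (rs (chain 0)) (chain ∘ suc)

chain-closure : ∀ {B : Set} {Step Rel : B → B → Set} (x : ℕ → B) → (∀ t → Step (x t) (x (suc t))) →
  (∀ u v → Step u v → Rel u v) → (∀ u v w → Rel u v → Step v w → Rel u w) →
  ∀ {a b} → a < b → Rel (x a) (x b)
chain-closure {Rel = Rel} x steps base extend a<b = along (≤⇒≤′ a<b)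
  where
    along : ∀ {a b} → suc a ≤′ b → Rel (x a) (x b)
    along {a} ≤′-refl = base _ _ (steps a)
    along (≤′-step {b} a<b) = extend _ _ _ (along a<b) (steps b)

invariant-along : ∀ {B : Set} {Step : B → B → Set} {P : B → Set} (x : ℕ → B) →
  (∀ t → Step (x t) (x (suc t))) → (∀ u v → Step u v → P u → P v) → P (x 0) → ∀ t → P (x t)
invariant-along x steps preserve P₀ zero = P₀
invariant-along x steps preserve P₀ (suc t) = preserve _ _ (steps t) (invariant-along x steps preserve P₀ t)

-- Infinite sets and Ramsey's theorem for pairs

Infinite : (ℕ → Set) → Set
Infinite P = ∀ n → ∃[ k ] n ≤ k × P k

finitely-⋃ : ∀ {m} {P : Fin m → ℕ → Set} →
  (∀ i → Finitely (P i)) → Finitely (λ k → ∃[ i ] P i k)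
finitely-⋃ {zero} _ = 0 , λ { _ _ (() , _) }
finitely-⋃ {suc m} fin with fin zero ∪-Fin finitely-⋃ (fin ∘ suc)
... | n , none = n , λ { k n≤k (zero , p) → none k n≤k (inj₁ p)
                       ; k n≤k (suc i , p) → none k n≤k (inj₂ (i , p)) }

infinite⇒increasing : ∀ {P : ℕ → Set} → Infinite P →
  ∃[ h ] (∀ t → h t < h (suc t)) × (∀ t → P (h t))
infinite⇒increasing {P} inf = h , (λ t → proj₁ (proj₂ (inf (suc (h t))))) , member
  where
    h : ℕ → ℕ
    h zero = proj₁ (inf 0)
    h (suc t) = proj₁ (inf (suc (h t)))
    member : ∀ t → P (h t)
    member zero = proj₂ (proj₂ (inf 0))
    member (suc t) = proj₂ (proj₂ (inf (suc (h t))))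

infinite-above : ∀ {P : ℕ → Set} → Infinite P → ∀ b → Infinite (λ l → P l × b < l)
infinite-above inf b n with inf (suc (n + b))
... | k , n+b<k , Pk = k , ≤-trans (m≤m+n n b) (<⇒≤ n+b<k) , Pk , ≤-<-trans (m≤n+m b n) n+b<k

module _ (lem : ExcludedMiddle 0ℓ) where

  private
    dne : DoubleNegationElimination 0ℓ
    dne = em⇒dne lem

  ¬infinite⇒finitely : ∀ {P : ℕ → Set} → ¬ Infinite P → Finitely P
  ¬infinite⇒finitely ¬inf = dne λ ¬fin →
    ¬inf λ n → dne λ ¬k → ¬fin (n , λ k n≤k Pk → ¬k (k , n≤k , Pk))

  infinite-pigeonhole : ∀ {m} {S : ℕ → Set} → Infinite S → (f : ℕ → Fin m) →
    ∃[ i ] Infinite (λ k → S k × f k ≡ i)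
  infinite-pigeonhole {S = S} inf f = dne λ noColour →
    let n , none = finitely-⋃ (λ i → ¬infinite⇒finitely (λ infᵢ → noColour (i , infᵢ)))
        k , n≤k , Sk = inf n
    in none k n≤k (f k , Sk , refl)

  module _ {m : ℕ} (colour : ℕ → ℕ → Fin m) where

    record Stage : Set₁ where
      field
        Member : ℕ → Set
        infinite : Infinite Member
    open Stage

    head : Stage → ℕ
    head S = proj₁ (infinite S 0)

    after-head : (S : Stage) → Infinite (λ l → Member S l × head S < l)
    after-head S = infinite-above (infinite S) (head S)

    headColour : Stage → Fin m
    headColour S = proj₁ (infinite-pigeonhole (after-head S) (colour (head S)))

    refine : Stage → Stage
    refine S = record
      { Member = λ l → (Member S l × head S < l) × colour (head S) l ≡ headColour S
      ; infinite = proj₂ (infinite-pigeonhole (after-head S) (colour (head S))) }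

    stage : ℕ → Stage
    stage zero = record { Member = λ _ → ⊤ ; infinite = λ n → n , ≤-refl , tt }
    stage (suc j) = refine (stage j)

    pivot : ℕ → ℕ
    pivot j = head (stage j)

    pivot-member : ∀ j → Member (stage j) (pivot j)
    pivot-member j = proj₂ (proj₂ (infinite (stage j) 0))

    stage-narrows : ∀ {j l x} → suc j ≤′ l → Member (stage l) x → Member (stage (suc j)) x
    stage-narrows ≤′-refl x∈ = x∈
    stage-narrows (≤′-step j<l) ((x∈ , _) , _) = stage-narrows j<l x∈

    pivot-homogeneous : ∀ {j l} → j < l →
      pivot j < pivot l × colour (pivot j) (pivot l) ≡ headColour (stage j)
    pivot-homogeneous {l = l} j<l with stage-narrows (≤⇒≤′ j<l) (pivot-member l)
    ... | (_ , lt) , same = lt , same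

    ramsey-chain : ∃₂ λ (i : Fin m) (g : ℕ → ℕ) →
      ∀ t → g t < g (suc t) × colour (g t) (g (suc t)) ≡ i
    ramsey-chain = i , pivot ∘ h , homogeneous
      where
        colours : ∃[ i ] Infinite (λ j → ⊤ × headColour (stage j) ≡ i)
        colours = infinite-pigeonhole (λ n → n , ≤-refl , tt) (headColour ∘ stage)
        i : Fin m
        i = proj₁ colours
        subsequence : ∃[ h ] (∀ t → h t < h (suc t)) × (∀ t → ⊤ × headColour (stage (h t)) ≡ i)
        subsequence = infinite⇒increasing (proj₂ colours)
        h : ℕ → ℕ
        h = proj₁ subsequence
        homogeneous : ∀ t → pivot (h t) < pivot (h (suc t)) × colour (pivot (h t)) (pivot (h (suc t))) ≡ i
        homogeneous t = let lt , same = pivot-homogeneous (proj₁ (proj₂ subsequence) t)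
                        in lt , trans same (proj₂ (proj₂ (proj₂ subsequence) t))

  wf-union⇒¬chain : ∀ {B : Set} (Rs : List (B → B → Set)) → All (WellFounded ∘ flip) Rs →
    (x : ℕ → B) → ¬ (∀ {a b} → a < b → Any (λ R → R (x a) (x b)) Rs)
  wf-union⇒¬chain Rs wfs x chain = refute (ramsey-chain colour)
    where
      colour : ℕ → ℕ → Fin (length Rs)
      colour a b with a <? b
      ... | yes a<b = Any.index (chain a<b)
      ... | no _ = Any.index (chain (n<1+n 0))

      colour-sound : ∀ {a b} → a < b → lookup Rs (colour a b) (x a) (x b)
      colour-sound {a} {b} a<b with a <? b
      ... | yes a<b = lookup-index (chain a<b)
      ... | no a≮b = contradiction a<b a≮b

      refute : ¬ ∃₂ λ i (g : ℕ → ℕ) → ∀ t → g t < g (suc t) × colour (g t) (g (suc t)) ≡ i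
      refute (i , g , homogeneous) =
        acc⇒¬chain (x ∘ g) (All.lookup wfs (∈-lookup i) (x (g 0))) λ t →
          let lt , same = homogeneous t
          in subst (λ j → lookup Rs j (x (g t)) (x (g (suc t)))) same (colour-sound lt)

module Schedule {A : Set₁} {B : Set} (⟦_⟧ : A → B → Set) (π : ℕ → B) where

  Often : List A → Set
  Often J = ∀ i → Infinite (⟦ lookup J i ⟧ ∘ π)

  visit : ∀ {P J} → Often (P ∷ J) → ℕ → ℕ
  visit often b = proj₁ (often zero (suc b))

  -- a, then the first visit to J₁ after b, the next visit to J₂, …, up to J_k.
  schedule : ∀ J → Often J → ℕ → ℕ → Fin (suc (length J)) → ℕ
  schedule J often a b zero = a
  schedule (P ∷ J) often a b (suc i) = schedule J (often ∘ suc) (visit often b) (visit often b) i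

  schedule-≥ : ∀ J (often : Often J) {a b} → a ≤ b → ∀ i → a ≤ schedule J often a b i
  schedule-≥ J often a≤b zero = ≤-refl
  schedule-≥ (P ∷ J) often {b = b} a≤b (suc i) =
    ≤-trans a≤b (≤-trans (<⇒≤ b<v) (schedule-≥ J (often ∘ suc) ≤-refl i))
    where
      b<v : b < visit often b
      b<v = proj₁ (proj₂ (often zero (suc b)))

  schedule-step : ∀ J (often : Often J) {a b} → a ≤ b → ∀ i →
    schedule J often a b (inject₁ i) < schedule J often a b (suc i) ×
    ⟦ lookup J i ⟧ (π (schedule J often a b (suc i)))
  schedule-step (P ∷ J) often {b = b} a≤b zero =
    let _ , b<v , Pv = often zero (suc b) in ≤-<-trans a≤b b<v , Pv
  schedule-step (P ∷ J) often a≤b (suc i) = schedule-step J (often ∘ suc) ≤-refl i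

module Semantics (E : Set) where
  open CTL E
  open Program

  module _ {A : Set₁} {σ : Sig} (D : Program σ) (f : A → Pred σ) where

    sat⇒evalS : ∀ φ {s} → NoQS φ → sat D (mapS f φ) s → evalS (mapS f φ) s
    sat⇒evalS (atom a) _ x = x
    sat⇒evalS (φ ∧ₛ ψ) (qφ , qψ) (x , y) = sat⇒evalS φ qφ x , sat⇒evalS ψ qψ y
    sat⇒evalS (φ ∨ₛ ψ) (qφ , qψ) (inj₁ x) = inj₁ (sat⇒evalS φ qφ x)
    sat⇒evalS (φ ∨ₛ ψ) (qφ , qψ) (inj₂ y) = inj₂ (sat⇒evalS ψ qψ y)

    evalS⇒sat : ∀ φ {s} → NoQS φ → evalS (mapS f φ) s → sat D (mapS f φ) s
    evalS⇒sat (atom a) _ x = x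
    evalS⇒sat (φ ∧ₛ ψ) (qφ , qψ) (x , y) = evalS⇒sat φ qφ x , evalS⇒sat ψ qψ y
    evalS⇒sat (φ ∨ₛ ψ) (qφ , qψ) (inj₁ x) = inj₁ (evalS⇒sat φ qφ x)
    evalS⇒sat (φ ∨ₛ ψ) (qφ , qψ) (inj₂ y) = inj₂ (evalS⇒sat ψ qψ y)

    psat⇒evalP : ∀ ψ {π} → IsAssnP ψ → psat D (mapP f ψ) π → evalP (mapP f ψ) (π 0)
    psat⇒evalP (st φ) qφ x = sat⇒evalS φ qφ x
    psat⇒evalP (φ ∧ₚ ψ) (aφ , aψ) (x , y) = psat⇒evalP φ aφ x , psat⇒evalP ψ aψ y
    psat⇒evalP (φ ∨ₚ ψ) (aφ , aψ) (inj₁ x) = inj₁ (psat⇒evalP φ aφ x)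
    psat⇒evalP (φ ∨ₚ ψ) (aφ , aψ) (inj₂ y) = inj₂ (psat⇒evalP ψ aψ y)

    evalP⇒psat : ∀ ψ {π} → IsAssnP ψ → evalP (mapP f ψ) (π 0) → psat D (mapP f ψ) π
    evalP⇒psat (st φ) qφ x = evalS⇒sat φ qφ x
    evalP⇒psat (φ ∧ₚ ψ) (aφ , aψ) (x , y) = evalP⇒psat φ aφ x , evalP⇒psat ψ aψ y
    evalP⇒psat (φ ∨ₚ ψ) (aφ , aψ) (inj₁ x) = inj₁ (evalP⇒psat φ aφ x)
    evalP⇒psat (φ ∨ₚ ψ) (aφ , aψ) (inj₂ y) = inj₂ (evalP⇒psat ψ aψ y)

  module _ {A : Set₁} {σ : Sig} (D₁ D₂ : Program σ) (f : A → Pred σ) where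

    psat-noQ : ∀ ψ {π} → NoQP ψ → psat D₁ (mapP f ψ) π → psat D₂ (mapP f ψ) π
    psat-noQ (st φ) qφ x = evalS⇒sat D₂ f φ qφ (sat⇒evalS D₁ f φ qφ x)
    psat-noQ (φ ∧ₚ ψ) (qφ , qψ) (x , y) = psat-noQ φ qφ x , psat-noQ ψ qψ y
    psat-noQ (φ ∨ₚ ψ) (qφ , qψ) (inj₁ x) = inj₁ (psat-noQ φ qφ x)
    psat-noQ (φ ∨ₚ ψ) (qφ , qψ) (inj₂ y) = inj₂ (psat-noQ ψ qψ y)
    psat-noQ (X ψ) qψ x = psat-noQ ψ qψ x
    psat-noQ (G ψ) qψ x = λ k → psat-noQ ψ qψ (x k)
    psat-noQ (φ U ψ) (qφ , qψ) (k , now , before) =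
      k , psat-noQ ψ qψ now , λ j j<k → psat-noQ φ qφ (before j j<k)

  module _ {σ : Sig} {init₁ init₂ : Pred σ} {step : State σ → State σ → Set} {J : List (Pred σ)} where
    private
      D₁ D₂ : Program σ
      D₁ = record { init = init₁ ; next = step ; fair = J }
      D₂ = record { init = init₂ ; next = step ; fair = J }

    sat-init : ∀ φ {s} → sat D₁ φ s → sat D₂ φ s
    psat-init : ∀ ψ {π} → psat D₁ ψ π → psat D₂ ψ π
    sat-init (atom a) x = x
    sat-init (φ ∧ₛ ψ) (x , y) = sat-init φ x , sat-init ψ y
    sat-init (φ ∨ₛ ψ) (inj₁ x) = inj₁ (sat-init φ x)
    sat-init (φ ∨ₛ ψ) (inj₂ y) = inj₂ (sat-init ψ y)
    sat-init (Q 𝔸 ψ) x = λ π start path → psat-init ψ (x π start path)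
    sat-init (Q 𝔼 ψ) (π , start , path , x) = π , start , path , psat-init ψ x
    sat-init (Q 𝔸f ψ) x = λ π start path fair → psat-init ψ (x π start path fair)
    sat-init (Q 𝔼f ψ) (π , start , path , fair , x) = π , start , path , fair , psat-init ψ x
    psat-init (st φ) x = sat-init φ x
    psat-init (φ ∧ₚ ψ) (x , y) = psat-init φ x , psat-init ψ y
    psat-init (φ ∨ₚ ψ) (inj₁ x) = inj₁ (psat-init φ x)
    psat-init (φ ∨ₚ ψ) (inj₂ y) = inj₂ (psat-init ψ y)
    psat-init (X ψ) x = psat-init ψ x
    psat-init (G ψ) x = λ k → psat-init ψ (x k)
    psat-init (φ U ψ) (k , now , before) = k , psat-init ψ now , λ j j<k → psat-init φ (before j j<k)

  module _ {A : Set₁} {σ : Sig} (D : Program σ) (f : A → Pred σ) {a b : SF A}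
           (b⇒a : ∀ {s} → sat D (mapS f b) s → sat D (mapS f a) s) where

    sat-RepS : ∀ {h φ φ'} → RepS a b h φ φ' → ∀ {s} → sat D (mapS f φ') s → sat D (mapS f φ) s
    psat-RepSP : ∀ {h ψ ψ'} → RepSP a b h ψ ψ' →
      ∀ {π} → psat D (mapP f ψ') π → psat D (mapP f ψ) π
    sat-RepS hit x = b⇒a x
    sat-RepS atom x = x
    sat-RepS (and r r') (x , y) = sat-RepS r x , sat-RepS r' y
    sat-RepS (or r r') (inj₁ x) = inj₁ (sat-RepS r x)
    sat-RepS (or r r') (inj₂ y) = inj₂ (sat-RepS r' y)
    sat-RepS (quant {q = 𝔸} r) x = λ π start path → psat-RepSP r (x π start path)
    sat-RepS (quant {q = 𝔼} r) (π , start , path , x) = π , start , path , psat-RepSP r x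
    sat-RepS (quant {q = 𝔸f} r) x = λ π start path fair → psat-RepSP r (x π start path fair)
    sat-RepS (quant {q = 𝔼f} r) (π , start , path , fair , x) = π , start , path , fair , psat-RepSP r x
    psat-RepSP (st r) x = sat-RepS r x
    psat-RepSP (and r r') (x , y) = psat-RepSP r x , psat-RepSP r' y
    psat-RepSP (or r r') (inj₁ x) = inj₁ (psat-RepSP r x)
    psat-RepSP (or r r') (inj₂ y) = inj₂ (psat-RepSP r' y)
    psat-RepSP (nxt r) x = psat-RepSP r x
    psat-RepSP (glb r) x = λ k → psat-RepSP r (x k)
    psat-RepSP (unt r r') (k , now , before) =
      k , psat-RepSP r' now , λ j j<k → psat-RepSP r (before j j<k)

  ShiftClosed : ∀ {ℓ σ} → (Path σ → Set ℓ) → Set ℓ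
  ShiftClosed Good = ∀ ρ → Good ρ → Good (shift 1 ρ)

  shiftClosed-shift : ∀ {ℓ σ} {Good : Path σ → Set ℓ} → ShiftClosed Good →
    ∀ k ρ → Good ρ → Good (shift k ρ)
  shiftClosed-shift closed zero ρ good = good
  shiftClosed-shift closed (suc k) ρ good = shiftClosed-shift closed k (shift 1 ρ) (closed ρ good)

  module _ {A : Set₁} {σ : Sig} (D : Program σ) (f : A → Pred σ) {a b : PF A}
           {ℓ : Level} {Good : Path σ → Set ℓ} (closed : ShiftClosed Good)
           (b⇒a : ∀ ρ → Good ρ → psat D (mapP f b) ρ → psat D (mapP f a) ρ) where

    psat-RepP : ∀ {h χ χ'} → RepP a b h χ χ' →
      ∀ ρ → Good ρ → psat D (mapP f χ') ρ → psat D (mapP f χ) ρ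
    psat-RepP hit ρ good x = b⇒a ρ good x
    psat-RepP st ρ good x = x
    psat-RepP (and r r') ρ good (x , y) = psat-RepP r ρ good x , psat-RepP r' ρ good y
    psat-RepP (or r r') ρ good (inj₁ x) = inj₁ (psat-RepP r ρ good x)
    psat-RepP (or r r') ρ good (inj₂ y) = inj₂ (psat-RepP r' ρ good y)
    psat-RepP (nxt r) ρ good x = psat-RepP r (shift 1 ρ) (closed ρ good) x
    psat-RepP (glb r) ρ good x = λ k → psat-RepP r (shift k ρ) (shiftClosed-shift closed k ρ good) (x k)
    psat-RepP (unt r r') ρ good (k , now , before) =
      k , psat-RepP r' (shift k ρ) (shiftClosed-shift closed k ρ good) now ,
      λ j j<k → psat-RepP r (shift j ρ) (shiftClosed-shift closed j ρ good) (before j j<k)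

  interpS : ∀ {σ} → Interp → SF (Atom σ) → SF (Pred σ)
  interpS I = mapS (λ a → a I)

  interpP : ∀ {σ} → Interp → PF (Atom σ) → PF (Pred σ)
  interpP I = mapP (λ a → a I)

  module _ {σ : Sig} (D : Program σ) (D' : Program (bool ∷ σ)) (I : Interp) where

    wk-sat⇒ : ∀ φ {s} → NoQS φ → sat D' (interpS I (mapS wkA φ)) s → sat D (interpS I φ) (proj₂ s)
    wk-sat⇒ (atom a) _ x = x
    wk-sat⇒ (φ ∧ₛ ψ) (qφ , qψ) (x , y) = wk-sat⇒ φ qφ x , wk-sat⇒ ψ qψ y
    wk-sat⇒ (φ ∨ₛ ψ) (qφ , qψ) (inj₁ x) = inj₁ (wk-sat⇒ φ qφ x)
    wk-sat⇒ (φ ∨ₛ ψ) (qφ , qψ) (inj₂ y) = inj₂ (wk-sat⇒ ψ qψ y)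

    wk-sat⇐ : ∀ φ {s} → NoQS φ → sat D (interpS I φ) (proj₂ s) → sat D' (interpS I (mapS wkA φ)) s
    wk-sat⇐ (atom a) _ x = x
    wk-sat⇐ (φ ∧ₛ ψ) (qφ , qψ) (x , y) = wk-sat⇐ φ qφ x , wk-sat⇐ ψ qψ y
    wk-sat⇐ (φ ∨ₛ ψ) (qφ , qψ) (inj₁ x) = inj₁ (wk-sat⇐ φ qφ x)
    wk-sat⇐ (φ ∨ₛ ψ) (qφ , qψ) (inj₂ y) = inj₂ (wk-sat⇐ ψ qψ y)

    wk-psat⇒ : ∀ ψ {ρ} → NoQP ψ →
      psat D' (interpP I (wkP ψ)) ρ → psat D (interpP I ψ) (proj₂ ∘ ρ)
    wk-psat⇒ (st φ) qφ x = wk-sat⇒ φ qφ x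
    wk-psat⇒ (φ ∧ₚ ψ) (qφ , qψ) (x , y) = wk-psat⇒ φ qφ x , wk-psat⇒ ψ qψ y
    wk-psat⇒ (φ ∨ₚ ψ) (qφ , qψ) (inj₁ x) = inj₁ (wk-psat⇒ φ qφ x)
    wk-psat⇒ (φ ∨ₚ ψ) (qφ , qψ) (inj₂ y) = inj₂ (wk-psat⇒ ψ qψ y)
    wk-psat⇒ (X ψ) qψ x = wk-psat⇒ ψ qψ x
    wk-psat⇒ (G ψ) qψ x = λ k → wk-psat⇒ ψ qψ (x k)
    wk-psat⇒ (φ U ψ) (qφ , qψ) (k , now , before) =
      k , wk-psat⇒ ψ qψ now , λ j j<k → wk-psat⇒ φ qφ (before j j<k)

    wk-psat⇐ : ∀ ψ {ρ} → NoQP ψ →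
      psat D (interpP I ψ) (proj₂ ∘ ρ) → psat D' (interpP I (wkP ψ)) ρ
    wk-psat⇐ (st φ) qφ x = wk-sat⇐ φ qφ x
    wk-psat⇐ (φ ∧ₚ ψ) (qφ , qψ) (x , y) = wk-psat⇐ φ qφ x , wk-psat⇐ ψ qψ y
    wk-psat⇐ (φ ∨ₚ ψ) (qφ , qψ) (inj₁ x) = inj₁ (wk-psat⇐ φ qφ x)
    wk-psat⇐ (φ ∨ₚ ψ) (qφ , qψ) (inj₂ y) = inj₂ (wk-psat⇐ ψ qψ y)
    wk-psat⇐ (X ψ) qψ x = wk-psat⇐ ψ qψ x
    wk-psat⇐ (G ψ) qψ x = λ k → wk-psat⇐ ψ qψ (x k)
    wk-psat⇐ (φ U ψ) (qφ , qψ) (k , now , before) =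
      k , wk-psat⇐ ψ qψ now , λ j j<k → wk-psat⇐ φ qφ (before j j<k)

  IsFair⇒All : ∀ {σ} (D : Program σ) {π} → IsFair D π → All (λ P → InfOften P π) (fair D)
  IsFair⇒All D isFair = lookup⇒All (fair D) isFair

  All⇒IsFair : ∀ {σ} (D : Program σ) {π} → All (λ P → InfOften P π) (fair D) → IsFair D π
  All⇒IsFair D often i = All.lookup often (∈-lookup i)

  InfOften-shift : ∀ {σ} {P : Pred σ} {π} → InfOften P π → InfOften P (shift 1 π)
  InfOften-shift often i with often (suc i)
  ... | suc j , s≤s i≤j , Pj = j , i≤j , Pj

  IsAssnP⇒NoQP : ∀ {A : Set₁} (ψ : PF A) → IsAssnP ψ → NoQP ψ
  IsAssnP⇒NoQP (st φ) qφ = qφ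
  IsAssnP⇒NoQP (φ ∧ₚ ψ) (aφ , aψ) = IsAssnP⇒NoQP φ aφ , IsAssnP⇒NoQP ψ aψ
  IsAssnP⇒NoQP (φ ∨ₚ ψ) (aφ , aψ) = IsAssnP⇒NoQP φ aφ , IsAssnP⇒NoQP ψ aψ

module Soundness (E : Set) (lem : ExcludedMiddle 0ℓ) where
  open CTL E
  open Program
  open SProg
  open Semantics E

  private
    dne : DoubleNegationElimination 0ℓ
    dne = em⇒dne lem

  ⟦_⟧ : ∀ {σ} → SProg σ → Interp → Program σ
  ⟦ D ⟧ I = record { init = Init D I ; next = Next D I ; fair = map (λ a → a I) (Fair D) }

  -- Rules (3)–(5)

  module Temporal {σ : Sig} (I : Interp) where

    TempSat : Temp σ → Path σ → Set
    TempSat (tX c) ρ = evP I c (shift 1 ρ 0)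
    TempSat (tG c) ρ = ∀ j → evP I c (shift j ρ 0)
    TempSat (tU c₁ c₂) ρ = ∃[ j ] evP I c₂ (shift j ρ 0) × (∀ i → i < j → evP I c₁ (shift i ρ 0))

    -- x ⇔ Unfolded T s s' x' is the conjunct that rules (3)–(5) add to next.
    Unfolded : Temp σ → State σ → State σ → Set → Set
    Unfolded (tX c) s s' later = evP I c s'
    Unfolded (tG c) s s' later = evP I c s × later
    Unfolded (tU c₁ c₂) s s' later = evP I c₂ s ⊎ (evP I c₁ s × later)

    unfold : ∀ T ρ → TempSat T ρ ⇔ Unfolded T (ρ 0) (ρ 1) (TempSat T (shift 1 ρ))
    unfold (tX c) ρ = (λ x → x) , (λ x → x)
    unfold (tG c) ρ = (λ always → always 0 , always ∘ suc) , λ where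
      (now , later) zero → now
      (now , later) (suc j) → later j
    unfold T@(tU c₁ c₂) ρ = to , from
      where
        to : TempSat T ρ → Unfolded T (ρ 0) (ρ 1) (TempSat T (shift 1 ρ))
        to (zero , now , _) = inj₁ now
        to (suc j , now , before) =
          inj₂ (before 0 (s≤s z≤n) , j , now , λ i i<j → before (suc i) (s≤s i<j))
        from : Unfolded T (ρ 0) (ρ 1) (TempSat T (shift 1 ρ)) → TempSat T ρ
        from (inj₁ now) = 0 , now , λ _ ()
        from (inj₂ (hold , j , now , before)) = suc j , now , λ where
          zero _ → hold
          (suc i) (s≤s i<j) → before i i<j

    TempSat-≗ : ∀ T {ρ ρ'} → ρ ≗ ρ' → TempSat T ρ → TempSat T ρ'
    TempSat-≗ (tX c) eq h = subst (evP I c) (eq 1) h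
    TempSat-≗ (tG c) eq always j = subst (evP I c) (eq (j + 0)) (always j)
    TempSat-≗ (tU c₁ c₂) eq (j , now , before) =
      j , subst (evP I c₂) (eq (j + 0)) now , λ i i<j → subst (evP I c₁) (eq (i + 0)) (before i i<j)

    Unfolded-map : ∀ T {s s'} {A B : Set} → (A → B) → Unfolded T s s' A → Unfolded T s s' B
    Unfolded-map (tX c) f u = u
    Unfolded-map (tG c) f (now , later) = now , f later
    Unfolded-map (tU c₁ c₂) f (inj₁ now) = inj₁ now
    Unfolded-map (tU c₁ c₂) f (inj₂ (hold , later)) = inj₂ (hold , f later)

    tNext≡Unfolded : ∀ T (p p' : State (bool ∷ σ)) →
      tNext T I p p' ≡ ((proj₁ p ≡ true) ⇔ Unfolded T (proj₂ p) (proj₂ p') (proj₁ p' ≡ true))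
    tNext≡Unfolded (tX c) p p' = refl
    tNext≡Unfolded (tG c) p p' = refl
    tNext≡Unfolded (tU c₁ c₂) p p' = refl

    TempSat⇒psat : ∀ (D : Program σ) T {ρ} → TempOK T → TempSat T ρ → psat D (interpP I (pat T)) ρ
    TempSat⇒psat D (tX c) ok h = evalP⇒psat D (λ a → a I) c ok h
    TempSat⇒psat D (tG c) ok always = λ j → evalP⇒psat D (λ a → a I) c ok (always j)
    TempSat⇒psat D (tU c₁ c₂) (ok₁ , ok₂) (j , now , before) =
      j , evalP⇒psat D (λ a → a I) c₂ ok₂ now ,
      λ i i<j → evalP⇒psat D (λ a → a I) c₁ ok₁ (before i i<j)

    pat-NoQP : ∀ (T : Temp σ) → TempOK T → NoQP (pat T)
    pat-NoQP (tX c) ok = IsAssnP⇒NoQP c ok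
    pat-NoQP (tG c) ok = IsAssnP⇒NoQP c ok
    pat-NoQP (tU c₁ c₂) (ok₁ , ok₂) = IsAssnP⇒NoQP c₁ ok₁ , IsAssnP⇒NoQP c₂ ok₂

    untrack : ∀ (D : Program σ) (D' : Program (bool ∷ σ)) T {ψ ψ'} → TempOK T → NoQP ψ →
      RepP (wkP (pat T)) (st (atom xAt)) true (wkP ψ) ψ' →
      ∀ {ℓ} {Good : Path (bool ∷ σ) → Set ℓ} → ShiftClosed Good →
      (∀ ρ → Good ρ → proj₁ (ρ 0) ≡ true → TempSat T (proj₂ ∘ ρ)) →
      ∀ π' → Good π' → psat D' (interpP I ψ') π' → psat D (interpP I ψ) (proj₂ ∘ π')
    untrack D D' T {ψ} ok qψ rep {Good = Good} closed tracks π' good x =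
      wk-psat⇒ D D' I ψ qψ (psat-RepP D' (λ a → a I) closed marked⇒pat rep π' good x)
      where
        marked⇒pat : ∀ ρ → Good ρ → proj₁ (ρ 0) ≡ true → psat D' (interpP I (wkP (pat T))) ρ
        marked⇒pat ρ g m = wk-psat⇐ D D' I (pat T) (pat-NoQP T ok) (TempSat⇒psat D T ok (tracks ρ g m))

    Monitors : Temp σ → Path (bool ∷ σ) → Set₁
    Monitors T π' = (∀ k → tNext T I (π' k) (π' (suc k))) × All (λ a → InfOften (a I) π') (tFair T)

    monitors-shift : ∀ {T} → ShiftClosed (Monitors T)
    monitors-shift π' (step , often) =
      (λ k → step (suc k)) , All.map (λ {a} → InfOften-shift {P = a I} {π'}) often

    monitored-G : ∀ (c : PF (Atom σ)) j (π' : Path (bool ∷ σ)) →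
      (∀ k → tNext (tG c) I (π' k) (π' (suc k))) → proj₁ (π' 0) ≡ true → evP I c (shift j (proj₂ ∘ π') 0)
    monitored-G c zero π' step m = proj₁ (proj₁ (step 0) m)
    monitored-G c (suc j) π' step m =
      monitored-G c j (shift 1 π') (λ k → step (suc k)) (proj₂ (proj₁ (step 0) m))

    -- The fairness condition ¬x ∨ c₂ is what forbids postponing c₂ forever.
    monitored-U : ∀ (c₁ c₂ : PF (Atom σ)) n (π' : Path (bool ∷ σ)) →
      (∀ k → tNext (tU c₁ c₂) I (π' k) (π' (suc k))) → proj₁ (π' 0) ≡ true →
      proj₁ (π' n) ≡ false ⊎ evP I c₂ (proj₂ (π' n)) → TempSat (tU c₁ c₂) (proj₂ ∘ π')
    monitored-U c₁ c₂ zero π' step m (inj₁ unmarked) = contradiction (trans (sym m) unmarked) λ ()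
    monitored-U c₁ c₂ zero π' step m (inj₂ now) = proj₂ (unfold (tU c₁ c₂) (proj₂ ∘ π')) (inj₁ now)
    monitored-U c₁ c₂ (suc n) π' step m release with proj₁ (step 0) m
    ... | inj₁ now = proj₂ (unfold (tU c₁ c₂) (proj₂ ∘ π')) (inj₁ now)
    ... | inj₂ (hold , m₁) = proj₂ (unfold (tU c₁ c₂) (proj₂ ∘ π'))
      (inj₂ (hold , monitored-U c₁ c₂ n (shift 1 π') (λ k → step (suc k)) m₁ release))

    monitors⇒TempSat : ∀ T π' → Monitors T π' → proj₁ (π' 0) ≡ true → TempSat T (proj₂ ∘ π')
    monitors⇒TempSat (tX c) π' (step , _) m = proj₁ (step 0) m
    monitors⇒TempSat (tG c) π' (step , _) m j = monitored-G c j π' step m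
    monitors⇒TempSat (tU c₁ c₂) π' (step , often ∷ []) m with often 0
    ... | n , _ , release = monitored-U c₁ c₂ n π' step m release

    marker : Temp σ → Path σ → ℕ → Bool
    marker T π k = does (lem {TempSat T (shift k π)})

    marked : Temp σ → Path σ → Path (bool ∷ σ)
    marked T π k = marker T π k , π k

    marker⇒ : ∀ T π k → marker T π k ≡ true → TempSat T (shift k π)
    marker⇒ T π k = does≡true⇒ lem

    marker⇐ : ∀ T π k → TempSat T (shift k π) → marker T π k ≡ true
    marker⇐ T π k = dec-true lem

    marked-step : ∀ T π k → tNext T I (marked T π k) (marked T π (suc k))
    marked-step T π k = subst id (sym (tNext≡Unfolded T _ _)) (to , from)
      where
        here : shift k π 0 ≡ π k
        here = cong π (+-identityʳ k)
        there : shift k π 1 ≡ π (suc k)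
        there = cong π (+-comm k 1)
        rest : shift 1 (shift k π) ≗ shift (suc k) π
        rest i = cong π (+-suc k i)
        to : marker T π k ≡ true → Unfolded T (π k) (π (suc k)) (marker T π (suc k) ≡ true)
        to m = subst₂ (λ s s' → Unfolded T s s' (marker T π (suc k) ≡ true)) here there
          (Unfolded-map T (marker⇐ T π (suc k) ∘ TempSat-≗ T rest)
            (proj₁ (unfold T (shift k π)) (marker⇒ T π k m)))
        from : Unfolded T (π k) (π (suc k)) (marker T π (suc k) ≡ true) → marker T π k ≡ true
        from u = marker⇐ T π k (proj₂ (unfold T (shift k π))
          (subst₂ (λ s s' → Unfolded T s s' (TempSat T (shift 1 (shift k π)))) (sym here) (sym there)
            (Unfolded-map T (TempSat-≗ T (sym ∘ rest) ∘ marker⇒ T π (suc k)) u)))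

    marked-often : ∀ T π → All (λ a → InfOften (a I) (marked T π)) (tFair T)
    marked-often (tX c) π = []
    marked-often (tG c) π = often ∷ []
      where
        often : ∀ i → ∃[ j ] i ≤ j × (marker (tG c) π j ≡ true ⊎ ¬ evP I c (π j))
        often i with lem {∃[ j ] i ≤ j × ¬ evP I c (π j)}
        ... | yes (j , i≤j , fails) = j , i≤j , inj₂ fails
        ... | no never = i , ≤-refl , inj₁ (marker⇐ (tG c) π i λ j →
          dne λ fails → never (i + (j + 0) , m≤m+n i (j + 0) , fails))
    marked-often (tU c₁ c₂) π = often ∷ []
      where
        often : ∀ i → ∃[ j ] i ≤ j × (marker (tU c₁ c₂) π j ≡ false ⊎ evP I c₂ (π j))
        often i with marker (tU c₁ c₂) π i in marked-i
        ... | false = i , ≤-refl , inj₁ marked-i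
        ... | true with marker⇒ (tU c₁ c₂) π i marked-i
        ...   | j , now , _ = i + (j + 0) , m≤m+n i (j + 0) , inj₂ now

    Tracks : Temp σ → Path (bool ∷ σ) → Set
    Tracks T π' = ∀ k → proj₁ (π' k) ≡ true → TempSat T (shift k (proj₂ ∘ π'))

    tracks-shift : ∀ {T} → ShiftClosed (Tracks T)
    tracks-shift π' tracks k = tracks (suc k)

  open Temporal
    using (untrack; marked; marked-step; marked-often; marker⇒; tracks-shift; monitors-shift; monitors⇒TempSat)

  module _ {σ : Sig} (D : SProg σ) (I : Interp) (ini : Atom (bool ∷ σ)) (T : Temp σ) where

    extend-fair⇒ : ∀ {π'} → IsFair (⟦ extend D ini T ⟧ I) π' →
      IsFair (⟦ D ⟧ I) (proj₂ ∘ π') × All (λ a → InfOften (a I) π') (tFair T)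
    extend-fair⇒ fair =
      let old , new = Allₚ.++⁻ (map wkA (Fair D)) (Allₚ.map⁻ (IsFair⇒All (⟦ extend D ini T ⟧ I) fair))
      in All⇒IsFair (⟦ D ⟧ I) (Allₚ.map⁺ (Allₚ.map⁻ old)) , new

    extend-fair⇐ : ∀ {π'} → IsFair (⟦ D ⟧ I) (proj₂ ∘ π') →
      All (λ a → InfOften (a I) π') (tFair T) → IsFair (⟦ extend D ini T ⟧ I) π'
    extend-fair⇐ fair new = All⇒IsFair (⟦ extend D ini T ⟧ I)
      (Allₚ.map⁺ (Allₚ.++⁺ (Allₚ.map⁺ (Allₚ.map⁻ (IsFair⇒All (⟦ D ⟧ I) fair))) new))

  module _ {σ : Sig} {D : SProg σ} {ψ : PF (Atom σ)} {ψ' : PF (Atom (bool ∷ σ))}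
           (T : Temp σ) (qψ : NoQP ψ) (ok : TempOK T)
           (rep : RepP (wkP (pat T)) (st (atom xAt)) true (wkP ψ) ψ') (I : Interp) where

    sound-temporal-A : ⟦ extend D (wkA (Init D)) T ⟧ I ⊨ interpS I (Q 𝔸f ψ') →
      ⟦ D ⟧ I ⊨ interpS I (Q 𝔸f ψ)
    sound-temporal-A extended s init π start path fair =
      untrack I (⟦ D ⟧ I) (⟦ extend D (wkA (Init D)) T ⟧ I) T ok qψ rep
        (tracks-shift I {T}) (λ ρ tracks → tracks 0) (marked I T π) (marker⇒ I T π)
        (extended (marked I T π 0) (subst (Init D I) (sym start) init) (marked I T π) refl
          (λ k → path k , marked-step I T π k)
          (extend-fair⇐ D I (wkA (Init D)) T fair (marked-often I T π)))

    sound-temporal-E : ∀ {n} → (∀ s → Init D I s → ∃[ x ] I n (bool ∷ σ) (x , s)) →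
      ⟦ extend D (app n) T ⟧ I ⊨ interpS I (Q 𝔼f ψ') → ⟦ D ⟧ I ⊨ interpS I (Q 𝔼f ψ)
    sound-temporal-E {n} aux extended s init with aux s init
    ... | x , ix with extended (x , s) ix
    ...   | π' , start , path , fair , holds =
      proj₂ ∘ π' , cong proj₂ start , (λ k → proj₁ (path k)) , proj₁ (extend-fair⇒ D I (app n) T fair) ,
      untrack I (⟦ D ⟧ I) (⟦ extend D (app n) T ⟧ I) T ok qψ rep
        (monitors-shift I {T}) (monitors⇒TempSat I T) π'
        ((λ k → proj₂ (path k)) , proj₂ (extend-fair⇒ D I (app n) T fair)) holds

  -- Rules (6) and (7)

  dwf⇒¬chain : ∀ {B : Set} {R : B → B → Set} → DWF R →
    (x : ℕ → B) → ¬ (∀ {a b} → a < b → R (x a) (x b))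
  dwf⇒¬chain (Rs , wfs , covers) x chain = wf-union⇒¬chain lem Rs wfs x (λ a<b → covers _ _ (chain a<b))

  p-has-no-fair-path : ∀ {σ} n (D : SProg σ) c I → All (Holds I) (clausesAf n D c) →
    ∀ {π} → IsPath (⟦ D ⟧ I) π → IsFair (⟦ D ⟧ I) π → ¬ I n σ (π 0)
  p-has-no-fair-path {σ} n record { Fair = [] } c I
    (_ ∷ lift p-step ∷ lift r-base ∷ dwf-r ∷ lift t-base ∷ lift t-step ∷ []) {π} path _ p₀ =
    dwf⇒¬chain dwf-r π λ {a} a<b →
      r-base _ _ (invariant-along π path p-step p₀ a) (chain-closure π path t-base t-step a<b)
  p-has-no-fair-path {σ} n D@record { Fair = J@(_ ∷ _) } c I
    (_ ∷ lift p-step ∷ lift r-fair ∷ dwf-r ∷ lift t-base ∷ lift t-step ∷ []) {π} path fair p₀ =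
    dwf⇒¬chain dwf-r (π ∘ round) r-rounds
    where
      open Schedule (λ (a : Atom σ) → a I) π

      often : Often J
      often i = All.lookup (Allₚ.map⁻ (IsFair⇒All (⟦ D ⟧ I) fair)) (∈-lookup i)

      round : ℕ → ℕ
      round zero = 0
      round (suc b) = schedule J often (round b) (round b) (fromℕ (length J))

      round-mono : ∀ {a b} → a ≤′ b → round a ≤ round b
      round-mono ≤′-refl = ≤-refl
      round-mono (≤′-step a≤b) =
        ≤-trans (round-mono a≤b) (schedule-≥ J often ≤-refl (fromℕ (length J)))

      r-rounds : ∀ {a b} → a < b → bin I (suc n) σ (π (round a)) (π (round b))
      r-rounds {a} {suc b} (s≤s a≤b) =
        r-fair (π ∘ schedule J often (round a) (round b)) (invariant-along π path p-step p₀ (round a)) λ i →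
          let lt , visited = schedule-step J often (round-mono (≤⇒≤′ a≤b)) i
          in chain-closure π path t-base t-step lt , visited

  cycⁿ : ∀ {k} → ℕ → Fin k → Fin k
  cycⁿ zero p = p
  cycⁿ (suc n) p = cyc (cycⁿ n p)

  suc-%-absorb : ∀ m d .{{_ : NonZero d}} → suc (m % d) % d ≡ suc m % d
  suc-%-absorb m d = begin
    (1 + m % d) % d          ≡⟨ %-distribˡ-+ 1 (m % d) d ⟩
    (1 % d + m % d % d) % d  ≡⟨ cong (λ r → (1 % d + r) % d) (m%n%n≡m%n m d) ⟩
    (1 % d + m % d) % d      ≡⟨ %-distribˡ-+ 1 m d ⟨
    (1 + m) % d              ∎

  toℕ-cycⁿ : ∀ {k} n (p : Fin (suc k)) → toℕ (cycⁿ n p) ≡ (n + toℕ p) % suc k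
  toℕ-cycⁿ zero p = sym (m<n⇒m%n≡m (toℕ<n p))
  toℕ-cycⁿ {k} (suc n) p = begin
    toℕ (cyc (cycⁿ n p))                ≡⟨ toℕ-fromℕ< _ ⟩
    suc (toℕ (cycⁿ n p)) % suc k        ≡⟨ cong (λ r → suc r % suc k) (toℕ-cycⁿ n p) ⟩
    suc ((n + toℕ p) % suc k) % suc k   ≡⟨ suc-%-absorb (n + toℕ p) (suc k) ⟩
    suc (n + toℕ p) % suc k             ∎

  cycⁿ-reaches : ∀ {k} (p i : Fin (suc k)) → ∃[ n ] cycⁿ n p ≡ i
  cycⁿ-reaches {k} p i = n , toℕ-injective (begin
    toℕ (cycⁿ n p)                              ≡⟨ toℕ-cycⁿ n p ⟩
    (toℕ i + (suc k ∸ toℕ p) + toℕ p) % suc k   ≡⟨ cong (_% suc k) (+-assoc (toℕ i) _ (toℕ p)) ⟩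
    (toℕ i + (suc k ∸ toℕ p + toℕ p)) % suc k   ≡⟨ cong (λ r → (toℕ i + r) % suc k) p+[k∸p]≡k ⟩
    (toℕ i + suc k) % suc k                     ≡⟨ [m+n]%n≡m%n (toℕ i) (suc k) ⟩
    toℕ i % suc k                               ≡⟨ m<n⇒m%n≡m (toℕ<n i) ⟩
    toℕ i                                       ∎)
    where
      n : ℕ
      n = toℕ i + (suc k ∸ toℕ p)
      p+[k∸p]≡k : suc k ∸ toℕ p + toℕ p ≡ suc k
      p+[k∸p]≡k = m∸n+n≡m (<⇒≤ (toℕ<n p))

  module PhaseMachine {B : Set} {k : ℕ} (q : Fin (suc k) → B → Set) (r : Fin (suc k) → B → B → Set)
      (J : Fin (suc k) → B → Set) (next : B → B → Set)
      (step : ∀ i s → q i s → ∃[ s' ] next s s' × ((J i s × q (cyc i) s') ⊎ (r i s s' × q i s')))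
      (dwf : ∀ i → DWF (r i)) (r-trans : ∀ i s s' s'' → r i s s' → r i s' s'' → r i s s'')
      {s₀ : B} (q₀ : q zero s₀) where

    Config : Set
    Config = ∃[ i ] Σ B (q i)

    successor : ∀ {i s s'} → (J i s × q (cyc i) s') ⊎ (r i s s' × q i s') → ∃[ j ] q j s'
    successor (inj₁ (_ , q')) = _ , q'
    successor (inj₂ (_ , q')) = _ , q'

    move : Config → Config
    move (i , s , q) =
      let s' , _ , choice = step i s q in proj₁ (successor choice) , s' , proj₂ (successor choice)

    run : ℕ → Config
    run zero = zero , s₀ , q₀
    run (suc t) = move (run t)

    phase : ℕ → Fin (suc k)
    phase t = proj₁ (run t)

    state : ℕ → B
    state t = proj₁ (proj₂ (run t))

    state-path : ∀ t → next (state t) (state (suc t))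
    state-path t = proj₁ (proj₂ (step (phase t) (state t) (proj₂ (proj₂ (run t)))))

    Advance Stay : ℕ → Set
    Advance t = J (phase t) (state t) × phase (suc t) ≡ cyc (phase t)
    Stay t = r (phase t) (state t) (state (suc t)) × phase (suc t) ≡ phase t

    classify : ∀ {i s s'} (choice : (J i s × q (cyc i) s') ⊎ (r i s s' × q i s')) →
      (J i s × proj₁ (successor choice) ≡ cyc i) ⊎ (r i s s' × proj₁ (successor choice) ≡ i)
    classify (inj₁ (visited , _)) = inj₁ (visited , refl)
    classify (inj₂ (decreased , _)) = inj₂ (decreased , refl)

    advance-or-stay : ∀ t → Advance t ⊎ Stay t
    advance-or-stay t = classify (proj₂ (proj₂ (step (phase t) (state t) (proj₂ (proj₂ (run t))))))

    -- Opaque because unfolding this classical proof in later conversion checks blows up type checking.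
    opaque
      advances-often : Infinite Advance
      advances-often = dne λ rarely → let N , none = ¬infinite⇒finitely lem rarely in
        dwf⇒¬chain (dwf (phase N)) (λ u → state (u + N))
          (chain-closure (λ u → state (u + N)) (r-steps N none) (λ _ _ → id) (r-trans (phase N)))
        where
          stays : ∀ N → (∀ t → N ≤ t → ¬ Advance t) → ∀ u → Stay (u + N)
          stays N none u with advance-or-stay (u + N)
          ... | inj₁ advanced = contradiction advanced (none (u + N) (m≤n+m N u))
          ... | inj₂ stayed = stayed
          phase-stays : ∀ N → (∀ t → N ≤ t → ¬ Advance t) → ∀ u → phase (u + N) ≡ phase N
          phase-stays N none zero = refl
          phase-stays N none (suc u) = trans (proj₂ (stays N none u)) (phase-stays N none u)
          r-steps : ∀ N → (∀ t → N ≤ t → ¬ Advance t) →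
            ∀ u → r (phase N) (state (u + N)) (state (suc u + N))
          r-steps N none u =
            subst (λ i → r i (state (u + N)) (state (suc u + N))) (phase-stays N none u) (proj₁ (stays N none u))

    advance-or-unchanged : ∀ {a c} → a ≤′ c →
      (∃[ b ] a ≤ b × Advance b × phase b ≡ phase a) ⊎ phase c ≡ phase a
    advance-or-unchanged ≤′-refl = inj₂ refl
    advance-or-unchanged (≤′-step {c} a≤c) with advance-or-unchanged a≤c
    ... | inj₁ found = inj₁ found
    ... | inj₂ unchanged with advance-or-stay c
    ...   | inj₁ advanced = inj₁ (c , ≤′⇒≤ a≤c , advanced , unchanged)
    ...   | inj₂ stayed = inj₂ (trans (proj₂ stayed) unchanged)

    next-advance : ∀ a → ∃[ b ] a ≤ b × Advance b × phase b ≡ phase a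
    next-advance a =
      let c , a≤c , advanced = advances-often a
      in [ id , (λ unchanged → c , a≤c , advanced , unchanged) ]′ (advance-or-unchanged (≤⇒≤′ a≤c))

    reach : ∀ n a → ∃[ b ] a ≤ b × phase b ≡ cycⁿ n (phase a)
    reach zero a = a , ≤-refl , refl
    reach (suc n) a =
      let b , a≤b , at-b = reach n a
          c , b≤c , (_ , moved) , same = next-advance b
      in suc c , ≤-trans a≤b (≤-trans b≤c (n≤1+n c)) , trans moved (cong cyc (trans same at-b))

    visits : ∀ i → Infinite (λ t → J i (state t))
    visits i a =
      let n , reaches = cycⁿ-reaches (phase a) i
          b , a≤b , at-b = reach n a
          c , b≤c , (visited , _) , same = next-advance b
      in c , ≤-trans a≤b b≤c , subst (λ j → J j (state c)) (trans same (trans at-b reaches)) visited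

  sound-Ef : ∀ {σ} n (D : SProg σ) c → IsAssnP c → ¬ Fair D ≡ [] → ∀ I →
    All (Holds I) (clausesEf n D c) → ⟦ D ⟧ I ⊨ interpS I (Q 𝔼f c)
  sound-Ef n record { Fair = [] } c ok nonempty = contradiction refl nonempty
  sound-Ef {σ} n D@record { Next = nx ; Fair = J@(_ ∷ _) } c ok _ I (lift start ∷ phases) s init =
    state , refl , state-path , All⇒IsFair (⟦ D ⟧ I) (Allₚ.map⁺ (lookup⇒All J visits)) ,
    evalP⇒psat (⟦ D ⟧ I) (λ a → a I) c ok (proj₁ (start s init))
    where
      -- The clauses for phase i, restated because the function generating them is local to clausesEf.
      phase-clauses : Fin (length J) → List Clause
      phase-clauses i =
          horn (λ I → ∀ s → I (n + toℕ i) σ s → Σ (State σ) λ s' → nx I s s' ×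
                 ((lookup J i I s × I (n + toℕ (cyc i)) σ s')
                  ⊎ (bin I (n + length J + toℕ i) σ s s' × I (n + toℕ i) σ s')))
        ∷ dwf (n + length J + toℕ i) σ
        ∷ horn (λ I → ∀ s s' s'' → bin I (n + length J + toℕ i) σ s s' →
                 bin I (n + length J + toℕ i) σ s' s'' → bin I (n + length J + toℕ i) σ s s'')
        ∷ []

      clauses : ∀ i → All (Holds I) (phase-clauses i)
      clauses = All-concatMap-allFin⁻ phase-clauses phases

      open PhaseMachine (λ i → I (n + toℕ i) σ) (λ i → bin I (n + length J + toℕ i) σ)
        (λ i → lookup J i I) (nx I)
        (λ i → lower (All.head (clauses i)))
        (λ i → All.head (All.tail (clauses i)))
        (λ i → lower (All.head (All.tail (All.tail (clauses i)))))
        (proj₂ (start s init))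

  sound-Ef∅ : ∀ {σ} n (D : SProg σ) c → IsAssnP c → Fair D ≡ [] → ∀ I →
    All (Holds I) (clausesEf∅ n D c) → ⟦ D ⟧ I ⊨ interpS I (Q 𝔼f c)
  sound-Ef∅ {σ} n D@record { Next = nx ; Fair = [] } c ok refl I (lift start ∷ lift step ∷ []) s init =
    state , refl , (λ t → proj₁ (proj₂ (step _ (proj₂ (run t))))) , (λ ()) ,
    evalP⇒psat (⟦ D ⟧ I) (λ a → a I) c ok (proj₁ (start s init))
    where
      run : ℕ → Σ (State σ) (I n σ)
      run zero = s , proj₂ (start s init)
      run (suc t) = let s' , _ , q' = step _ (proj₂ (run t)) in s' , q'
      state : Path σ
      state = proj₁ ∘ run

  sound : ∀ {σ n m} {D : SProg σ} {φ Cs} → Trans n D φ Cs m →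
    ∀ I → All (Holds I) Cs → ⟦ D ⟧ I ⊨ interpS I φ
  sound {D = D} (r1 {φ₁ = φ₁} {C₁ = C₁} _ rep t₁ t₂) I holds s init =
    let holds₁ , holds₂ = Allₚ.++⁻ C₁ holds
    in sat-RepS (⟦ D ⟧ I) (λ a → a I) (λ {s} aux → sat-init (interpS I φ₁) (sound t₁ I holds₁ s aux)) rep
         (sound t₂ I holds₂ s init)
  sound {D = D} (r2A {ψ = ψ} qψ t) I holds s init π start path =
    psat-noQ (⟦ noFair D ⟧ I) (⟦ D ⟧ I) (λ a → a I) ψ qψ (sound t I holds s init π start path λ ())
  sound {D = D} (r2E {ψ = ψ} qψ t) I holds s init with sound t I holds s init
  ... | π , start , path , _ , holds-ψ =
    π , start , path , psat-noQ (⟦ noFair D ⟧ I) (⟦ D ⟧ I) (λ a → a I) ψ qψ holds-ψ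
  sound {D = D} (r345A T qψ ok rep t) I holds = sound-temporal-A {D = D} T qψ ok rep I (sound t I holds)
  sound {D = D} (r345E T qψ ok rep t) I (lift aux ∷ holds) =
    sound-temporal-E {D = D} T qψ ok rep I aux (sound t I holds)
  sound {n = n} {D = D} (r6 {c = c} ok) I holds s init π start path fair with lem {evP I c s}
  ... | yes now = evalP⇒psat (⟦ D ⟧ I) (λ a → a I) c ok (subst (evP I c) (sym start) now)
  ... | no fails = contradiction (subst (I n _) (sym start) (lower (All.head holds) s init fails))
                     (p-has-no-fair-path n D c I holds path fair)
  sound {n = n} {D = D} (r7 {c = c} ok nonempty) I holds = sound-Ef n D c ok nonempty I holds
  sound {n = n} {D = D} (r7∅ {c = c} ok empty) I holds = sound-Ef∅ n D c ok empty I holds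
  sound {D = D} (r8 {c = c} ok) I (lift holds ∷ []) s init =
    evalS⇒sat (⟦ D ⟧ I) (λ a → a I) c ok (holds s init)

theorem2 : (E : Set) → let open CTL E in
    ExcludedMiddle 0ℓ →
    (n : ℕ) (D : Program (replicate n ent)) (φ : SF (Pred (replicate n ent)))
    (Cs : List Clause) (m : ℕ) →
    Trans 0 (liftProg D) (liftF φ) Cs m →
    Satisfiable Cs →
    D ⊨ φ
theorem2 E lem n D φ Cs m translation (I , holds) =
  subst₂ _⊨_ lowered-program (mapS-inverse (λ _ → refl) φ) (sound translation I holds)
  where
    open CTL E
    open Program
    open Soundness E lem
    lowered-program : ⟦ liftProg D ⟧ I ≡ D
    lowered-program = cong (λ J → record { init = init D ; next = next D ; fair = J })
      (trans (sym (map-∘ (fair D))) (map-id (fair D)))
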